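{- For every positive integer $r$, $m(r) = 2^r + 2$.
   Context: This conjecture is proved in the paper's appendix. For a positive integer $n$, the unitary Cayley graph $X_n = \mathrm{Cay}(\mathbb{Z}_n, U_n)$ has vertex set $\mathbb{Z}_n$, and $x,y$ are adjacent iff $x - y \in U_n$, the group of units of $\mathbb{Z}_n$. An induced cycle of length $k \geq 3$ is a sequence of $k$ distinct vertices $v_0, \dots, v_{k-1}$ such that $v_i$ and $v_j$ are adjacent if and only if $i - j \equiv \pm 1 \pmod k$. $M(n)$ denotes the length of the longest induced cycle in $X_n$, and $m(r) = \max_n M(n)$ over all $n$ with exactly $r$ distinct prime divisors. -}

module Defs where

open import Data.Nat using (ℕ; zero; suc; _+_; _∸_; _^_; _≤_; _%_)
open import Data.Nat.Divisibility using (_∣_)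
open import Data.Nat.Primality using (Prime)
open import Data.Nat.Coprimality using (Coprime)
open import Data.Fin using (Fin; toℕ)
open import Data.List using (List; length)
open import Data.List.Membership.Propositional using (_∈_)
open import Data.List.Relation.Unary.Unique.Propositional using (Unique)
open import Data.Product using (Σ; _×_)
open import Data.Sum using (_⊎_)
open import Function.Definitions using (Injective)
open import Function.Bundles using (_⇔_)
open import Relation.Binary.PropositionalEquality using (_≡_)

-- The difference x - y computed in ℤ_n (vertices of ℤ_n are represented by Fin n).
diffMod : (n : ℕ) → Fin n → Fin n → ℕ
diffMod (suc n) x y = (toℕ x + (suc n ∸ toℕ y)) % suc n

-- a ∈ ℤ_n (represented by 0 ≤ a < n) is a unit iff gcd(a, n) = 1.
IsUnit : ℕ → ℕ → Set
IsUnit n a = Coprime a n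

-- Adjacency in the unitary Cayley graph X_n = Cay(ℤ_n, U_n): x - y ∈ U_n.
Adj : (n : ℕ) → Fin n → Fin n → Set
Adj n x y = IsUnit n (diffMod n x y)

sucMod : (k : ℕ) → Fin k → ℕ
sucMod (suc k) i = suc (toℕ i) % suc k

CycNeighbours : (k : ℕ) → Fin k → Fin k → Set
CycNeighbours k i j = (sucMod k j ≡ toℕ i) ⊎ (sucMod k i ≡ toℕ j)

IsInducedCycle : (n k : ℕ) → (Fin k → Fin n) → Set
IsInducedCycle n k v =
  (3 ≤ k) × Injective _≡_ _≡_ v ×
  ((i j : Fin k) → Adj n (v i) (v j) ⇔ CycNeighbours k i j)

HasExactlyPrimeDivisors : ℕ → ℕ → Set
HasExactlyPrimeDivisors n r =
  Σ (List ℕ) λ ps → (length ps ≡ r) × Unique ps ×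
    ((p : ℕ) → (p ∈ ps) ⇔ (Prime p × p ∣ n))

module Submission where

-- Vertices x, y of X_n are adjacent iff x ≢ y modulo every prime p ∣ n.
-- Upper bound: for the r prime divisors p, the product ∏ₚ (x mod p − y mod p) is a bilinear pairing
-- of vectors F x, G y ∈ ℤ^(2^r). Along an induced cycle v₀, …, v_{k−1} the matrix of pairings
-- F vᵢ · G v_{j+1} (i, j < k − 2) is triangular with nonzero diagonal, hence k − 2 ≤ 2^r.
-- Lower bound: X_4 contains an induced 4-cycle, and an induced (m + 2)-cycle in X_n doubles to an
-- induced (2m + 2)-cycle in X_{np}, p a prime factor of 2n + 1, by folding the new cycle onto the
-- old one (Chinese remaindering) and using the residue mod p, with 3 values, to cut unwanted edges.

module IntegerVectors where

  open import Data.Integer using (ℤ; 0ℤ; -1ℤ; +_; _+_; _-_; _*_; _≟_)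
  import Data.Integer.Properties as ℤ
  open import Data.Integer.Tactic.RingSolver using (solve-∀)
  open import Data.Nat using (ℕ; zero; suc; _<_; _≤_; _^_; z≤n; s≤s)
  open import Data.Fin using (Fin; zero; suc)
  open import Data.Vec using (Vec; []; _∷_; lookup; zipWith; map; _++_; removeAt)
  open import Data.List using (List; []; _∷_; length)
  open import Data.List.Relation.Unary.All using (All; []; _∷_)
  open import Data.Product using (∃; _,_)
  open import Data.Sum using (inj₁; inj₂)
  open import Data.Empty using (⊥-elim)
  open import Function.Bundles using (_⇔_; mk⇔)
  open import Relation.Nullary using (yes; no)
  open import Relation.Binary.PropositionalEquality

  infix 7 _∙_

  _∙_ : ∀ {R} → Vec ℤ R → Vec ℤ R → ℤ
  [] ∙ [] = 0ℤ
  (a ∷ u) ∙ (b ∷ w) = a * b + u ∙ w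

  ∙-++ : ∀ {R S} (u : Vec ℤ R) (u′ : Vec ℤ S) w w′ → (u ++ u′) ∙ (w ++ w′) ≡ u ∙ w + u′ ∙ w′
  ∙-++ [] u′ [] w′ = sym (ℤ.+-identityˡ _)
  ∙-++ (a ∷ u) u′ (b ∷ w) w′ = trans (cong (_+_ (a * b)) (∙-++ u u′ w w′)) (sym (ℤ.+-assoc (a * b) _ _))

  ∙-scaleˡ : ∀ {R} k (u w : Vec ℤ R) → map (k *_) u ∙ w ≡ k * (u ∙ w)
  ∙-scaleˡ k [] [] = sym (ℤ.*-zeroʳ k)
  ∙-scaleˡ k (a ∷ u) (b ∷ w) = trans (cong (_+_ (k * a * b)) (∙-scaleˡ k u w)) (distrib k a b (u ∙ w))
    where distrib : ∀ k a b d → k * a * b + k * d ≡ k * (a * b + d)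
          distrib = solve-∀

  ∙-scaleʳ : ∀ {R} k (u w : Vec ℤ R) → u ∙ map (k *_) w ≡ k * (u ∙ w)
  ∙-scaleʳ k [] [] = sym (ℤ.*-zeroʳ k)
  ∙-scaleʳ k (a ∷ u) (b ∷ w) = trans (cong (_+_ (a * (k * b))) (∙-scaleʳ k u w)) (distrib k a b (u ∙ w))
    where distrib : ∀ k a b d → a * (k * b) + k * d ≡ k * (a * b + d)
          distrib = solve-∀

  combine : ∀ {R} → ℤ → Vec ℤ R → ℤ → Vec ℤ R → Vec ℤ R
  combine a u b w = zipWith (λ x y → a * x - b * y) u w

  ∙-combine : ∀ {R} a (u : Vec ℤ R) b w g → combine a u b w ∙ g ≡ a * (u ∙ g) - b * (w ∙ g)
  ∙-combine a [] b [] [] = zeros a b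
    where zeros : ∀ a b → 0ℤ ≡ a * 0ℤ - b * 0ℤ
          zeros = solve-∀
  ∙-combine a (x ∷ u) b (y ∷ w) (z ∷ g) =
    trans (cong (_+_ ((a * x - b * y) * z)) (∙-combine a u b w g)) (distrib a x b y z (u ∙ g) (w ∙ g))
    where distrib : ∀ a x b y z d e → (a * x - b * y) * z + (a * d - b * e) ≡ a * (x * z + d) - b * (y * z + e)
          distrib = solve-∀

  lookup-combine : ∀ {R} a (u : Vec ℤ R) b w c → lookup (combine a u b w) c ≡ a * lookup u c - b * lookup w c
  lookup-combine a (x ∷ u) b (y ∷ w) zero = refl
  lookup-combine a (x ∷ u) b (y ∷ w) (suc c) = lookup-combine a u b w c

  ∙-removeAt : ∀ {R} (u w : Vec ℤ (suc R)) c → lookup u c ≡ 0ℤ → removeAt u c ∙ removeAt w c ≡ u ∙ w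
  ∙-removeAt (a ∷ u) (b ∷ w) zero refl = sym (ℤ.+-identityˡ (u ∙ w))
  ∙-removeAt (a ∷ a′ ∷ u) (b ∷ b′ ∷ w) (suc c) uc≡0 = cong (_+_ (a * b)) (∙-removeAt (a′ ∷ u) (b′ ∷ w) c uc≡0)

  ∙≢0⇒nonzeroEntry : ∀ {R} (u w : Vec ℤ R) → u ∙ w ≢ 0ℤ → ∃ λ c → lookup u c ≢ 0ℤ
  ∙≢0⇒nonzeroEntry [] [] u∙w≢0 = ⊥-elim (u∙w≢0 refl)
  ∙≢0⇒nonzeroEntry (a ∷ u) (b ∷ w) u∙w≢0 with a ≟ 0ℤ
  ... | no a≢0 = zero , a≢0
  ... | yes refl with ∙≢0⇒nonzeroEntry u w (λ e → u∙w≢0 (trans (ℤ.+-identityˡ (u ∙ w)) e))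
  ...   | c , uc≢0 = suc c , uc≢0

  nonsingularTriangular⇒≤dim : ∀ R N (f g : ℕ → Vec ℤ R) →
    (∀ {i j} → i < j → j < N → f i ∙ g j ≡ 0ℤ) →
    (∀ {i} → i < N → f i ∙ g i ≢ 0ℤ) → N ≤ R
  nonsingularTriangular⇒≤dim R zero f g _ _ = z≤n
  nonsingularTriangular⇒≤dim zero (suc N) f g _ diagonal = ⊥-elim (diagonal {0} (s≤s z≤n) (empty (f 0) (g 0)))
    where empty : (u w : Vec ℤ 0) → u ∙ w ≡ 0ℤ
          empty [] [] = refl
  nonsingularTriangular⇒≤dim (suc R) (suc N) f g above diagonal
    with ∙≢0⇒nonzeroEntry (f 0) (g 0) (diagonal (s≤s z≤n))
  ... | c , a≢0 = s≤s (nonsingularTriangular⇒≤dim R N f′ g′ above′ diagonal′)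
    where
    a = lookup (f 0) c
    b : ℕ → ℤ
    b i = lookup (f (suc i)) c
    row : ℕ → Vec ℤ (suc R)
    row i = combine a (f (suc i)) (b i) (f 0)
    cleared : ∀ i → lookup (row i) c ≡ 0ℤ
    cleared i = trans (lookup-combine a (f (suc i)) (b i) (f 0) c) (cancel a (b i))
      where cancel : ∀ a b → a * b - b * a ≡ 0ℤ
            cancel = solve-∀
    f′ g′ : ℕ → Vec ℤ R
    f′ i = removeAt (row i) c
    g′ j = removeAt (g (suc j)) c
    eliminated : ∀ i {j} → j < N → f′ i ∙ g′ j ≡ a * (f (suc i) ∙ g (suc j))
    eliminated i {j} j<N = begin
      f′ i ∙ g′ j                           ≡⟨ ∙-removeAt (row i) (g (suc j)) c (cleared i) ⟩
      row i ∙ g (suc j)                     ≡⟨ ∙-combine a (f (suc i)) (b i) (f 0) (g (suc j)) ⟩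
      a * d - b i * (f 0 ∙ g (suc j))       ≡⟨ cong (λ t → a * d - b i * t) (above (s≤s z≤n) (s≤s j<N)) ⟩
      a * d - b i * 0ℤ                      ≡⟨ dropZero a d (b i) ⟩
      a * d                                 ∎
      where
      open ≡-Reasoning
      d = f (suc i) ∙ g (suc j)
      dropZero : ∀ a x b → a * x - b * 0ℤ ≡ a * x
      dropZero = solve-∀
    above′ : ∀ {i j} → i < j → j < N → f′ i ∙ g′ j ≡ 0ℤ
    above′ {i} {j} i<j j<N = begin
      f′ i ∙ g′ j                  ≡⟨ eliminated i j<N ⟩
      a * (f (suc i) ∙ g (suc j))  ≡⟨ cong (a *_) (above (s≤s i<j) (s≤s j<N)) ⟩
      a * 0ℤ                       ≡⟨ ℤ.*-zeroʳ a ⟩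
      0ℤ                           ∎
      where open ≡-Reasoning
    diagonal′ : ∀ {i} → i < N → f′ i ∙ g′ i ≢ 0ℤ
    diagonal′ {i} i<N e with ℤ.i*j≡0⇒i≡0∨j≡0 a (trans (sym (eliminated i i<N)) e)
    ... | inj₁ a≡0 = a≢0 a≡0
    ... | inj₂ d≡0 = diagonal (s≤s i<N) d≡0

  -- Expanding ∏ₚ (φ p - ψ p) gives 2 ^ length ps monomials, each a signed product of some φ p
  -- times the product of the remaining ψ p; these are split into a φ-part and a ψ-part.
  monomialsˡ : ∀ {A : Set} → (A → ℤ) → (ps : List A) → Vec ℤ (2 ^ length ps)
  monomialsˡ φ [] = + 1 ∷ []
  monomialsˡ φ (p ∷ ps) = map (φ p *_) (monomialsˡ φ ps) ++ map (-1ℤ *_) (monomialsˡ φ ps) ++ []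

  monomialsʳ : ∀ {A : Set} → (A → ℤ) → (ps : List A) → Vec ℤ (2 ^ length ps)
  monomialsʳ ψ [] = + 1 ∷ []
  monomialsʳ ψ (p ∷ ps) = monomialsʳ ψ ps ++ map (ψ p *_) (monomialsʳ ψ ps) ++ []

  ∏-diff : ∀ {A : Set} → (A → ℤ) → (A → ℤ) → List A → ℤ
  ∏-diff φ ψ [] = + 1
  ∏-diff φ ψ (p ∷ ps) = (φ p - ψ p) * ∏-diff φ ψ ps

  ∙-monomials : ∀ {A : Set} (φ ψ : A → ℤ) ps → monomialsˡ φ ps ∙ monomialsʳ ψ ps ≡ ∏-diff φ ψ ps
  ∙-monomials φ ψ [] = refl
  ∙-monomials φ ψ (p ∷ ps) = begin
      (map (φ p *_) M ++ map (-1ℤ *_) M ++ []) ∙ (N ++ map (ψ p *_) N ++ [])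
    ≡⟨ ∙-++ (map (φ p *_) M) _ N _ ⟩
      map (φ p *_) M ∙ N + (map (-1ℤ *_) M ++ []) ∙ (map (ψ p *_) N ++ [])
    ≡⟨ cong (_+_ (map (φ p *_) M ∙ N)) (∙-++ (map (-1ℤ *_) M) [] (map (ψ p *_) N) []) ⟩
      map (φ p *_) M ∙ N + (map (-1ℤ *_) M ∙ map (ψ p *_) N + 0ℤ)
    ≡⟨ cong₂ (λ s t → s + (t + 0ℤ)) (∙-scaleˡ (φ p) M N)
             (trans (∙-scaleˡ -1ℤ M (map (ψ p *_) N)) (cong (-1ℤ *_) (∙-scaleʳ (ψ p) M N))) ⟩
      φ p * (M ∙ N) + (-1ℤ * (ψ p * (M ∙ N)) + 0ℤ)
    ≡⟨ cong (λ d → φ p * d + (-1ℤ * (ψ p * d) + 0ℤ)) (∙-monomials φ ψ ps) ⟩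
      φ p * ∏-diff φ ψ ps + (-1ℤ * (ψ p * ∏-diff φ ψ ps) + 0ℤ)
    ≡⟨ factor (φ p) (ψ p) (∏-diff φ ψ ps) ⟩
      (φ p - ψ p) * ∏-diff φ ψ ps
    ∎
    where
    open ≡-Reasoning
    M = monomialsˡ φ ps
    N = monomialsʳ ψ ps
    factor : ∀ x y d → x * d + (-1ℤ * (y * d) + 0ℤ) ≡ (x - y) * d
    factor = solve-∀

  ∏-diff≢0⇔distinct : ∀ {A : Set} (φ ψ : A → ℤ) ps → ∏-diff φ ψ ps ≢ 0ℤ ⇔ All (λ p → φ p ≢ ψ p) ps
  ∏-diff≢0⇔distinct φ ψ ps = mk⇔ (to ps) (from ps)
    where
    to : ∀ ps → ∏-diff φ ψ ps ≢ 0ℤ → All (λ p → φ p ≢ ψ p) ps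
    to [] _ = []
    to (p ∷ ps) ∏≢0 = (λ φp≡ψp → ∏≢0 (headZero φp≡ψp)) ∷ to ps (λ ∏≡0 → ∏≢0 (tailZero ∏≡0))
      where
      headZero : φ p ≡ ψ p → ∏-diff φ ψ (p ∷ ps) ≡ 0ℤ
      headZero e rewrite e = trans (cong (_* ∏-diff φ ψ ps) (ℤ.+-inverseʳ (ψ p))) (ℤ.*-zeroˡ (∏-diff φ ψ ps))
      tailZero : ∏-diff φ ψ ps ≡ 0ℤ → ∏-diff φ ψ (p ∷ ps) ≡ 0ℤ
      tailZero e rewrite e = ℤ.*-zeroʳ (φ p - ψ p)
    from : ∀ ps → All (λ p → φ p ≢ ψ p) ps → ∏-diff φ ψ ps ≢ 0ℤ
    from [] [] ()
    from (p ∷ ps) (φp≢ψp ∷ rest) ∏≡0 with ℤ.i*j≡0⇒i≡0∨j≡0 (φ p - ψ p) ∏≡0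
    ... | inj₁ d≡0 = φp≢ψp (ℤ.i-j≡0⇒i≡j (φ p) (ψ p) d≡0)
    ... | inj₂ ∏′≡0 = from ps rest ∏′≡0

open IntegerVectors
  using (_∙_; nonsingularTriangular⇒≤dim; monomialsˡ; monomialsʳ; ∙-monomials; ∏-diff≢0⇔distinct)

open import Defs
open import Data.Nat as ℕ using (ℕ; zero; suc; _+_; _*_; _∸_; _^_; _≤_; _<_; z≤n; s≤s; _%_; NonZero; _≟_; _≤?_; _<?_)
import Data.Nat.Properties as ℕ
open import Data.Nat.DivMod using (%-remove-+ˡ; %-remove-+ʳ; %-distribˡ-+; m<n⇒m%n≡m; n%n≡0; m%n<n; m∣n⇒o%n%m≡o%m)
open import Data.Nat.Tactic.RingSolver using (solve-∀)
open import Data.Nat.Divisibility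
open import Data.Nat.Primality
open import Data.Nat.Primality.Factorisation using (factorise)
open import Data.Nat.ListAction using (product)
open import Data.Nat.Coprimality using (Coprime)
open import Data.Integer as ℤ using (ℤ; 0ℤ)
import Data.Integer.Properties as ℤ
open import Data.Fin as Fin using (Fin; toℕ; fromℕ<)
import Data.Fin.Properties as Fin
open import Data.Vec using (Vec)
open import Data.List using (List; []; _∷_; length)
open import Data.List.Membership.Propositional using (_∈_)
open import Data.List.Relation.Unary.All as All using (All; []; _∷_)
open import Data.List.Relation.Unary.Any using (here; there)
open import Data.List.Relation.Unary.AllPairs using ([]; _∷_)
open import Data.List.Relation.Unary.Unique.Propositional using (Unique)
open import Data.Product using (Σ; ∃; _×_; _,_; proj₁; proj₂)
open import Data.Sum using (_⊎_; inj₁; inj₂; [_,_]′; reduce)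
open import Data.Sum.Function.Propositional using (_⊎-⇔_)
open import Data.Empty using (⊥-elim)
open import Function.Base using (_∘_)
open import Function.Bundles using (_⇔_; mk⇔; Equivalence)
import Function.Properties.Equivalence as ⇔
open import Relation.Nullary using (¬_; yes; no)
open import Relation.Nullary.Decidable using (Dec; decidable-stable; map′; toWitness; _×-dec_; _⊎-dec_; _→-dec_; ¬?)
open import Relation.Binary.PropositionalEquality

open Equivalence using (to; from)

-- The residue of x modulo p, with junk value x at p = 0 so that no NonZero instance is needed.
residue : ℕ → ℕ → ℕ
residue x zero = x
residue x (suc p) = x % suc p

residue≡% : ∀ x p .{{_ : NonZero p}} → residue x p ≡ x % p
residue≡% x (suc p) = refl

residue-%-multiple : ∀ x {q n} .{{_ : NonZero n}} → q ∣ n → residue (x % n) q ≡ residue x q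
residue-%-multiple x {zero} {n} 0∣n = ⊥-elim (ℕ.≢-nonZero⁻¹ n (0∣⇒≡0 0∣n))
residue-%-multiple x {suc q} {n} q∣n = m∣n⇒o%n%m≡o%m (suc q) n x q∣n

Separated : List ℕ → ℕ → ℕ → Set
Separated ps x y = All (λ p → residue x p ≢ residue y p) ps

PrimeDivisorList : ℕ → List ℕ → Set
PrimeDivisorList n ps = ∀ p → p ∈ ps ⇔ (Prime p × p ∣ n)

prime⇒≢1 : ∀ {p} → Prime p → p ≢ 1
prime⇒≢1 pp = ℕ.nonTrivial⇒≢1 {{prime⇒nonTrivial pp}}

∣prime⇒≡ : ∀ {p q} → Prime p → Prime q → q ∣ p → q ≡ p
∣prime⇒≡ pp pq q∣p with prime⇒irreducible pp q∣p
... | inj₁ q≡1 = ⊥-elim (prime⇒≢1 pq q≡1)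
... | inj₂ q≡p = q≡p

∃primeDivisor : ∀ {n} → 2 ≤ n → ∃ λ p → Prime p × p ∣ n
∃primeDivisor {1} (s≤s ())
∃primeDivisor {n@(suc (suc _))} _ with factorise n
... | record { factors = [] ; isFactorisation = () }
... | record { factors = p ∷ ps ; isFactorisation = n≡∏ ; factorsPrime = pp ∷ _ } =
  p , pp , subst (p ∣_) (sym n≡∏) (m∣m*n (product ps))

prime∣1+2n⇒∤2n : ∀ {p} n → Prime p → p ∣ suc (n + n) → ¬ p ∣ n + n
prime∣1+2n⇒∤2n {p} n pp p∣1+2n p∣2n =
  prime⇒≢1 pp (∣1⇒≡1 (∣m+n∣m⇒∣n (subst (p ∣_) (ℕ.+-comm 1 (n + n)) p∣1+2n) p∣2n))

coprime⇔noCommonPrimeDivisor : ∀ {d} n .{{_ : NonZero n}} →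
  Coprime d n ⇔ (∀ {p} → Prime p → p ∣ n → ¬ p ∣ d)
coprime⇔noCommonPrimeDivisor {d} n = mk⇔ noCommon common≡1
  where
  noCommon : Coprime d n → ∀ {p} → Prime p → p ∣ n → ¬ p ∣ d
  noCommon coprime pp p∣n p∣d = prime⇒≢1 pp (coprime (p∣d , p∣n))
  common≡1 : (∀ {p} → Prime p → p ∣ n → ¬ p ∣ d) → ∀ {i} → i ∣ d × i ∣ n → i ≡ 1
  common≡1 _ {0} (_ , 0∣n) = ⊥-elim (ℕ.≢-nonZero⁻¹ n (0∣⇒≡0 0∣n))
  common≡1 _ {1} _ = refl
  common≡1 noCommon {suc (suc i)} (i∣d , i∣n) with ∃primeDivisor {suc (suc i)} (s≤s (s≤s z≤n))
  ... | p , pp , p∣i = ⊥-elim (noCommon pp (∣-trans p∣i i∣n) (∣-trans p∣i i∣d))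

∣x+[n∸y]⇔%≡ : ∀ {n p} x y .{{_ : NonZero p}} → p ∣ n → y ≤ n → p ∣ x + (n ∸ y) ⇔ x % p ≡ y % p
∣x+[n∸y]⇔%≡ {n} {p} x y p∣n y≤n = mk⇔ ⇒ ⇐
  where
  z = n ∸ y
  p∣y+z : p ∣ y + z
  p∣y+z = subst (p ∣_) (sym (ℕ.m+[n∸m]≡n y≤n)) p∣n
  ⇒ : p ∣ x + z → x % p ≡ y % p
  ⇒ p∣x+z = begin
    x % p              ≡⟨ %-remove-+ʳ x p∣y+z ⟨
    (x + (y + z)) % p  ≡⟨ cong (_% p) (rearrange x y z) ⟩
    ((x + z) + y) % p  ≡⟨ %-remove-+ˡ y p∣x+z ⟩
    y % p              ∎
    where
    open ≡-Reasoning
    rearrange : ∀ x y z → x + (y + z) ≡ (x + z) + y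
    rearrange x y z = trans (cong (x +_) (ℕ.+-comm y z)) (sym (ℕ.+-assoc x z y))
  ⇐ : x % p ≡ y % p → p ∣ x + z
  ⇐ x≡y = m%n≡0⇒n∣m (x + z) p (begin
    (x + z) % p            ≡⟨ %-distribˡ-+ x z p ⟩
    (x % p + z % p) % p    ≡⟨ cong (λ t → (t + z % p) % p) x≡y ⟩
    (y % p + z % p) % p    ≡⟨ %-distribˡ-+ y z p ⟨
    (y + z) % p            ≡⟨ n∣m⇒m%n≡0 (y + z) p p∣y+z ⟩
    0                      ∎)
    where open ≡-Reasoning

∣diffMod⇔residue≡ : ∀ {n p} → p ∣ n → (x y : Fin n) →
  p ∣ diffMod n x y ⇔ residue (toℕ x) p ≡ residue (toℕ y) p
∣diffMod⇔residue≡ {suc n} {zero} 0∣n _ _ = ⊥-elim (ℕ.0≢1+n (sym (0∣⇒≡0 0∣n)))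
∣diffMod⇔residue≡ {suc n} {suc p} p∣n x y = ⇔.trans
  (mk⇔ (∣n∣m%n⇒∣m p∣n) (λ p∣t → %-presˡ-∣ p∣t p∣n))
  (∣x+[n∸y]⇔%≡ (toℕ x) (toℕ y) p∣n (ℕ.<⇒≤ (Fin.toℕ<n y)))

adj⇔separated : ∀ {n ps} → PrimeDivisorList n ps → (x y : Fin n) → Adj n x y ⇔ Separated ps (toℕ x) (toℕ y)
adj⇔separated {suc n} {ps} primeDivisors x y = ⇔.trans (coprime⇔noCommonPrimeDivisor (suc n)) (mk⇔ ⇒ ⇐)
  where
  ⇒ : (∀ {p} → Prime p → p ∣ suc n → ¬ p ∣ diffMod (suc n) x y) → Separated ps (toℕ x) (toℕ y)
  ⇒ noCommon = All.tabulate λ {p} p∈ps → let (pp , p∣n) = to (primeDivisors p) p∈ps in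
    λ x≡y → noCommon pp p∣n (from (∣diffMod⇔residue≡ p∣n x y) x≡y)
  ⇐ : Separated ps (toℕ x) (toℕ y) → ∀ {p} → Prime p → p ∣ suc n → ¬ p ∣ diffMod (suc n) x y
  ⇐ separated {p} pp p∣n p∣d =
    All.lookup separated (from (primeDivisors p) (pp , p∣n)) (to (∣diffMod⇔residue≡ p∣n x y) p∣d)

primeDivisors-square : ∀ {p} → Prime p → PrimeDivisorList (p * p) (p ∷ [])
primeDivisors-square {p} pp q = mk⇔ ⇒ ⇐
  where
  ⇒ : q ∈ p ∷ [] → Prime q × q ∣ p * p
  ⇒ (here refl) = pp , n∣m*n p
  ⇐ : Prime q × q ∣ p * p → q ∈ p ∷ []
  ⇐ (pq , q∣p*p) = here (∣prime⇒≡ pp pq (reduce (euclidsLemma p p pq q∣p*p)))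

primeDivisors-*prime : ∀ {n ps p} → PrimeDivisorList n ps → Prime p → PrimeDivisorList (n * p) (p ∷ ps)
primeDivisors-*prime {n} {ps} {p} primeDivisors pp q = mk⇔ ⇒ ⇐
  where
  ⇒ : q ∈ p ∷ ps → Prime q × q ∣ n * p
  ⇒ (here refl) = pp , n∣m*n n
  ⇒ (there q∈ps) = let (pq , q∣n) = to (primeDivisors q) q∈ps in pq , ∣m⇒∣m*n p q∣n
  ⇐ : Prime q × q ∣ n * p → q ∈ p ∷ ps
  ⇐ (pq , q∣np) with euclidsLemma n p pq q∣np
  ... | inj₁ q∣n = there (from (primeDivisors q) (pq , q∣n))
  ... | inj₂ q∣p = here (∣prime⇒≡ pp pq q∣p)

Follows : ℕ → ℕ → ℕ → Set
Follows L a b = (suc a ≡ b) ⊎ (b ≡ 0 × suc a ≡ L)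

CycleAdjacent : ℕ → ℕ → ℕ → Set
CycleAdjacent L a b = Follows L b a ⊎ Follows L a b

cycleAdjacent-sym : ∀ {L a b} → CycleAdjacent L a b → CycleAdjacent L b a
cycleAdjacent-sym (inj₁ b→a) = inj₂ b→a
cycleAdjacent-sym (inj₂ a→b) = inj₁ a→b

sucMod≡⇔follows : ∀ {K} (i j : Fin K) → sucMod K i ≡ toℕ j ⇔ Follows K (toℕ i) (toℕ j)
sucMod≡⇔follows {suc K} i j with ℕ.m≤n⇒m<n∨m≡n (Fin.toℕ<n i)
... | inj₁ 1+i<K = mk⇔
  (λ e → inj₁ (trans (sym (m<n⇒m%n≡m 1+i<K)) e))
  (λ { (inj₁ e) → trans (m<n⇒m%n≡m 1+i<K) e
     ; (inj₂ (_ , 1+i≡K)) → ⊥-elim (ℕ.<-irrefl 1+i≡K 1+i<K) })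
... | inj₂ 1+i≡K = mk⇔
  (λ e → inj₂ (trans (sym e) wrapsToZero , 1+i≡K))
  (λ { (inj₁ e) → ⊥-elim (ℕ.<-irrefl (trans (sym e) 1+i≡K) (Fin.toℕ<n j))
     ; (inj₂ (j≡0 , _)) → trans wrapsToZero (sym j≡0) })
  where
  wrapsToZero : suc (toℕ i) % suc K ≡ 0
  wrapsToZero = trans (cong (_% suc K) 1+i≡K) (n%n≡0 (suc K))

cycNeighbours⇔cycleAdjacent : ∀ {K} (i j : Fin K) → CycNeighbours K i j ⇔ CycleAdjacent K (toℕ i) (toℕ j)
cycNeighbours⇔cycleAdjacent i j = sucMod≡⇔follows j i ⊎-⇔ sucMod≡⇔follows i j

SeparatedCycle : List ℕ → ℕ → (ℕ → ℕ) → Set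
SeparatedCycle ps K w = ∀ {a b} → a < K → b < K → Separated ps (w a) (w b) ⇔ CycleAdjacent K a b

-- v read as a sequence of natural numbers, with junk value 0 beyond the cycle
vertexAt : ∀ {K n} → (Fin K → Fin n) → ℕ → ℕ
vertexAt {K} v a with a <? K
... | yes a<K = toℕ (v (fromℕ< a<K))
... | no _ = 0

vertexAt-fromℕ< : ∀ {K n} (v : Fin K → Fin n) {a} (a<K : a < K) → vertexAt v a ≡ toℕ (v (fromℕ< a<K))
vertexAt-fromℕ< {K} v {a} a<K with a <? K
... | yes a<K′ = cong (λ h → toℕ (v (fromℕ< h))) (ℕ.<-irrelevant a<K′ a<K)
... | no a≮K = ⊥-elim (a≮K a<K)

inducedCycle⇒separatedCycle : ∀ {n K ps} {v : Fin K → Fin n} → PrimeDivisorList n ps →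
  IsInducedCycle n K v → SeparatedCycle ps K (vertexAt v)
inducedCycle⇒separatedCycle {K = K} {ps} {v} primeDivisors (_ , _ , adj⇔neighbours) {a} {b} a<K b<K
  rewrite vertexAt-fromℕ< v a<K | vertexAt-fromℕ< v b<K =
  subst₂ (λ a b → Separated ps (toℕ (v i)) (toℕ (v j)) ⇔ CycleAdjacent K a b)
    (Fin.toℕ-fromℕ< a<K) (Fin.toℕ-fromℕ< b<K)
    (⇔.trans (⇔.sym (adj⇔separated primeDivisors (v i) (v j)))
      (⇔.trans (adj⇔neighbours i j) (cycNeighbours⇔cycleAdjacent i j)))
  where
  i = fromℕ< a<K
  j = fromℕ< b<K

separatedCycle⇒inducedCycle : ∀ {n K ps w} → PrimeDivisorList n ps → 3 ≤ K →
  (w<n : ∀ {a} → a < K → w a < n) → (∀ {a b} → a < K → b < K → w a ≡ w b → a ≡ b) →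
  SeparatedCycle ps K w → IsInducedCycle n K (λ i → fromℕ< (w<n (Fin.toℕ<n i)))
separatedCycle⇒inducedCycle {n} {K} {ps} {w} primeDivisors 3≤K w<n w-injective separatedCycle =
  3≤K , injective , adj⇔neighbours
  where
  v : Fin K → Fin n
  v i = fromℕ< (w<n (Fin.toℕ<n i))
  toℕ-v : ∀ i → toℕ (v i) ≡ w (toℕ i)
  toℕ-v i = Fin.toℕ-fromℕ< (w<n (Fin.toℕ<n i))
  injective : ∀ {i j} → v i ≡ v j → i ≡ j
  injective {i} {j} vi≡vj = Fin.toℕ-injective (w-injective (Fin.toℕ<n i) (Fin.toℕ<n j)
    (trans (sym (toℕ-v i)) (trans (cong toℕ vi≡vj) (toℕ-v j))))
  adj⇔neighbours : ∀ i j → Adj n (v i) (v j) ⇔ CycNeighbours K i j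
  adj⇔neighbours i j = ⇔.trans (adj⇔separated primeDivisors (v i) (v j))
    (⇔.trans (subst₂ (λ x y → Separated ps (toℕ (v i)) (toℕ (v j)) ⇔ Separated ps x y) (toℕ-v i) (toℕ-v j) ⇔.refl)
      (⇔.trans (separatedCycle (Fin.toℕ<n i) (Fin.toℕ<n j)) (⇔.sym (cycNeighbours⇔cycleAdjacent i j))))

residueℤ : ℕ → ℕ → ℤ
residueℤ x p = ℤ.+ residue x p

monomials≢0⇔separated : ∀ ps x y →
  monomialsˡ (residueℤ x) ps ∙ monomialsʳ (residueℤ y) ps ≢ 0ℤ ⇔ Separated ps x y
monomials≢0⇔separated ps x y = mk⇔
  (λ ∙≢0 → All.map (λ ne → ne ∘ cong (λ r → ℤ.+ r)) (to ∏≢0⇔distinct (∙≢0 ∘ trans (∙-monomials φ ψ ps))))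
  (λ separated → from ∏≢0⇔distinct (All.map (_∘ ℤ.+-injective) separated) ∘ trans (sym (∙-monomials φ ψ ps)))
  where
  φ = residueℤ x
  ψ = residueℤ y
  ∏≢0⇔distinct = ∏-diff≢0⇔distinct φ ψ ps

farApart⇒¬cycleAdjacent : ∀ {N i j} → i < j → j < N → ¬ CycleAdjacent (suc (suc N)) i (suc j)
farApart⇒¬cycleAdjacent {j = j} i<j _ (inj₁ (inj₁ 2+j≡i)) =
  ℕ.<-irrefl (sym 2+j≡i) (ℕ.<-trans i<j (ℕ.m<n⇒m<1+n (ℕ.n<1+n j)))
farApart⇒¬cycleAdjacent _ j<N (inj₁ (inj₂ (_ , 2+j≡2+N))) = ℕ.<-irrefl (ℕ.suc-injective (ℕ.suc-injective 2+j≡2+N)) j<N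
farApart⇒¬cycleAdjacent i<j _ (inj₂ (inj₁ 1+i≡1+j)) = ℕ.<-irrefl (ℕ.suc-injective 1+i≡1+j) i<j
farApart⇒¬cycleAdjacent _ _ (inj₂ (inj₂ (() , _)))

-- Pairing the φ-monomials of vertex i with the ψ-monomials of vertex j + 1 gives a triangular
-- system with nonzero diagonal: for i ≤ j < N the vertices i and j + 1 are adjacent iff i = j.
separatedCycle⇒length≤ : ∀ ps N w → SeparatedCycle ps (suc (suc N)) w → N ≤ 2 ^ length ps
separatedCycle⇒length≤ ps N w separatedCycle = nonsingularTriangular⇒≤dim _ N f g above diagonal
  where
  f g : ℕ → Vec ℤ (2 ^ length ps)
  f i = monomialsˡ (residueℤ (w i)) ps
  g j = monomialsʳ (residueℤ (w (suc j))) ps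
  above : ∀ {i j} → i < j → j < N → f i ∙ g j ≡ 0ℤ
  above {i} {j} i<j j<N = decidable-stable (f i ∙ g j ℤ.≟ 0ℤ) λ ∙≢0 →
    farApart⇒¬cycleAdjacent i<j j<N
      (to (separatedCycle (ℕ.<-trans i<j (ℕ.m<n⇒m<1+n (ℕ.m<n⇒m<1+n j<N))) (s≤s (ℕ.m<n⇒m<1+n j<N)))
        (to (monomials≢0⇔separated ps (w i) (w (suc j))) ∙≢0))
  diagonal : ∀ {i} → i < N → f i ∙ g i ≢ 0ℤ
  diagonal {i} i<N = from (monomials≢0⇔separated ps (w i) (w (suc i)))
    (from (separatedCycle (ℕ.m<n⇒m<1+n (ℕ.m<n⇒m<1+n i<N)) (s≤s (ℕ.m<n⇒m<1+n i<N))) (inj₂ (inj₁ refl)))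

inducedCycle⇒length≤ : ∀ {n k r} {v : Fin k → Fin n} → HasExactlyPrimeDivisors n r →
  IsInducedCycle n k v → k ≤ 2 ^ r + 2
inducedCycle⇒length≤ {k = suc (suc N)} (ps , refl , _ , primeDivisors) inducedCycle =
  subst (_≤ 2 ^ length ps + 2) (ℕ.+-comm N 2)
    (ℕ.+-monoˡ-≤ 2 (separatedCycle⇒length≤ ps N _ (inducedCycle⇒separatedCycle primeDivisors inducedCycle)))
inducedCycle⇒length≤ {k = 0} _ (() , _)
inducedCycle⇒length≤ {k = 1} _ (s≤s () , _)

oneTwo : ℕ → ℕ
oneTwo 0 = 2
oneTwo 1 = 1
oneTwo (suc (suc x)) = oneTwo x

oneTwo≢0 : ∀ x → oneTwo x ≢ 0
oneTwo≢0 0 ()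
oneTwo≢0 1 ()
oneTwo≢0 (suc (suc x)) = oneTwo≢0 x

oneTwo-suc≢ : ∀ x → oneTwo x ≢ oneTwo (suc x)
oneTwo-suc≢ 0 ()
oneTwo-suc≢ 1 ()
oneTwo-suc≢ (suc (suc x)) = oneTwo-suc≢ x

oneTwo<3 : ∀ x → oneTwo x < 3
oneTwo<3 0 = s≤s (s≤s (s≤s z≤n))
oneTwo<3 1 = s≤s (s≤s z≤n)
oneTwo<3 (suc (suc x)) = oneTwo<3 x

-- The cycle 0, 1, …, 2m + 1 folded onto the cycle 0, 1, …, m + 1: a ↦ height a walks up to m + 1
-- and back down. The colouring separates consecutive vertices but gives the same colour to a and
-- the vertices of the other half whose heights differ from that of a by one, so that only the
-- consecutive pairs survive; 0 and m + 1 share colour 0 to destroy the folded edge between them.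
module Folding (m : ℕ) where

  L K : ℕ
  L = suc (suc (m + m))
  K = suc (suc m)

  height : ℕ → ℕ
  height a with a ≤? suc m
  ... | yes _ = a
  ... | no _ = L ∸ a

  colour : ℕ → ℕ
  colour a with a ≟ 0 | a ≤? m | a ≟ suc m
  ... | yes _ | _     | _     = 0
  ... | no _  | yes _ | _     = oneTwo a
  ... | no _  | no _  | yes _ = 0
  ... | no _  | no _  | no _  = oneTwo (suc (L ∸ a))

  data Place (a : ℕ) : Set where
    start   : a ≡ 0 → Place a
    ascent  : 1 ≤ a → a ≤ m → Place a
    summit  : a ≡ suc m → Place a
    descent : ∀ u → a + u ≡ L → 1 ≤ u → u ≤ m → Place a

  heightOf : ∀ {a} → Place a → ℕ
  heightOf (start _) = 0
  heightOf {a} (ascent _ _) = a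
  heightOf (summit _) = suc m
  heightOf (descent u _ _ _) = u

  colourOf : ∀ {a} → Place a → ℕ
  colourOf (start _) = 0
  colourOf {a} (ascent _ _) = oneTwo a
  colourOf (summit _) = 0
  colourOf (descent u _ _ _) = oneTwo (suc u)

  descent-bounds : ∀ {a u} → a + u ≡ L → u ≤ m → K ≤ a × L ∸ a ≡ u
  descent-bounds {a} {u} a+u≡L u≤m = K≤a , trans (cong (_∸ a) (sym a+u≡L)) (ℕ.m+n∸m≡n a u)
    where
    K≤a : K ≤ a
    K≤a = ℕ.+-cancelʳ-≤ m K a (ℕ.≤-trans (ℕ.≤-reflexive (sym a+u≡L)) (ℕ.+-monoʳ-≤ a u≤m))

  descent⇒≰1+m : ∀ {a u} → a + u ≡ L → u ≤ m → ¬ a ≤ suc m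
  descent⇒≰1+m a+u≡L u≤m a≤1+m = ℕ.<-irrefl refl (ℕ.≤-trans (proj₁ (descent-bounds a+u≡L u≤m)) a≤1+m)

  height≡ : ∀ {a} (p : Place a) → height a ≡ heightOf p
  height≡ {a} p with a ≤? suc m | p
  ... | yes _     | start a≡0 = a≡0
  ... | yes _     | ascent _ _ = refl
  ... | yes _     | summit a≡1+m = a≡1+m
  ... | yes a≤1+m | descent u a+u≡L _ u≤m = ⊥-elim (descent⇒≰1+m a+u≡L u≤m a≤1+m)
  ... | no a≰1+m  | start refl = ⊥-elim (a≰1+m z≤n)
  ... | no a≰1+m  | ascent _ a≤m = ⊥-elim (a≰1+m (ℕ.m≤n⇒m≤1+n a≤m))
  ... | no a≰1+m  | summit refl = ⊥-elim (a≰1+m ℕ.≤-refl)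
  ... | no _      | descent u a+u≡L _ u≤m = proj₂ (descent-bounds a+u≡L u≤m)

  colour≡ : ∀ {a} (p : Place a) → colour a ≡ colourOf p
  colour≡ {a} p with a ≟ 0 | a ≤? m | a ≟ suc m | p
  ... | yes _    | _        | _        | start _ = refl
  ... | yes refl | _        | _        | ascent 1≤a _ = ⊥-elim (ℕ.<-irrefl refl 1≤a)
  ... | yes refl | _        | _        | summit ()
  ... | yes refl | _        | _        | descent u u≡L _ u≤m = ⊥-elim (descent⇒≰1+m u≡L u≤m z≤n)
  ... | no a≢0   | _        | _        | start a≡0 = ⊥-elim (a≢0 a≡0)
  ... | no _     | yes _    | _        | ascent _ _ = refl
  ... | no _     | no a≰m   | _        | ascent _ a≤m = ⊥-elim (a≰m a≤m)
  ... | no _     | yes a≤m  | _        | summit refl = ⊥-elim (ℕ.<-irrefl refl a≤m)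
  ... | no _     | no _     | yes _    | summit _ = refl
  ... | no _     | no _     | no a≢1+m | summit a≡1+m = ⊥-elim (a≢1+m a≡1+m)
  ... | no _     | yes a≤m  | _        | descent u a+u≡L _ u≤m = ⊥-elim (descent⇒≰1+m a+u≡L u≤m (ℕ.m≤n⇒m≤1+n a≤m))
  ... | no _     | no _     | yes refl | descent u a+u≡L _ u≤m = ⊥-elim (descent⇒≰1+m a+u≡L u≤m ℕ.≤-refl)
  ... | no _     | no _     | no _     | descent u a+u≡L _ u≤m = cong (oneTwo ∘ suc) (proj₂ (descent-bounds a+u≡L u≤m))

  place : ∀ {a} → a < L → Place a
  place {a} a<L with a ≟ 0 | a ≤? m | a ≟ suc m
  ... | yes a≡0 | _       | _        = start a≡0
  ... | no a≢0  | yes a≤m | _        = ascent (ℕ.n≢0⇒n>0 a≢0) a≤m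
  ... | no _     | no _    | yes a≡1+m = summit a≡1+m
  ... | no _     | no a≰m  | no a≢1+m  = descent (L ∸ a) (ℕ.m+[n∸m]≡n (ℕ.<⇒≤ a<L)) (ℕ.m<n⇒0<n∸m a<L) L∸a≤m
    where
    K≤a : K ≤ a
    K≤a = ℕ.≤∧≢⇒< (ℕ.≰⇒> a≰m) (a≢1+m ∘ sym)
    L∸a≤m : L ∸ a ≤ m
    L∸a≤m = ℕ.≤-trans (ℕ.∸-monoʳ-≤ L K≤a) (ℕ.≤-reflexive (ℕ.m+n∸m≡n K m))

  heightOf<K : ∀ {a} (p : Place a) → heightOf p < K
  heightOf<K (start _) = s≤s z≤n
  heightOf<K (ascent _ a≤m) = s≤s (ℕ.m≤n⇒m≤1+n a≤m)
  heightOf<K (summit _) = ℕ.≤-refl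
  heightOf<K (descent _ _ _ u≤m) = s≤s (ℕ.m≤n⇒m≤1+n u≤m)

  colourOf<3 : ∀ {a} (p : Place a) → colourOf p < 3
  colourOf<3 (start _) = s≤s z≤n
  colourOf<3 {a} (ascent _ _) = oneTwo<3 a
  colourOf<3 (summit _) = s≤s z≤n
  colourOf<3 (descent u _ _ _) = oneTwo<3 (suc u)

  heightOf≡0⇒colourOf≡0 : ∀ {a} (p : Place a) → heightOf p ≡ 0 → colourOf p ≡ 0
  heightOf≡0⇒colourOf≡0 (start _) _ = refl
  heightOf≡0⇒colourOf≡0 (ascent 1≤a _) a≡0 = ⊥-elim (ℕ.<-irrefl (sym a≡0) 1≤a)
  heightOf≡0⇒colourOf≡0 (descent _ _ 1≤u _) u≡0 = ⊥-elim (ℕ.<-irrefl (sym u≡0) 1≤u)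

  heightOf≡1+m⇒colourOf≡0 : ∀ {a} (p : Place a) → heightOf p ≡ suc m → colourOf p ≡ 0
  heightOf≡1+m⇒colourOf≡0 (ascent _ a≤m) a≡1+m = ⊥-elim (ℕ.<-irrefl a≡1+m (s≤s a≤m))
  heightOf≡1+m⇒colourOf≡0 (summit _) _ = refl
  heightOf≡1+m⇒colourOf≡0 (descent _ _ _ u≤m) u≡1+m = ⊥-elim (ℕ.<-irrefl u≡1+m (s≤s u≤m))

  descent-cancel : ∀ {a b u} → a + u ≡ L → b + u ≡ L → a ≡ b
  descent-cancel {a} {b} {u} a+u≡L b+u≡L = ℕ.+-cancelʳ-≡ u a b (trans a+u≡L (sym b+u≡L))

  placesFollow⇒cycleAdjacent : ∀ {a b} (p : Place a) (q : Place b) →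
    Follows K (heightOf p) (heightOf q) → colourOf p ≢ colourOf q → CycleAdjacent L a b
  placesFollow⇒cycleAdjacent p q (inj₂ (hq≡0 , 1+hp≡K)) c≢ =
    ⊥-elim (c≢ (trans (heightOf≡1+m⇒colourOf≡0 p (ℕ.suc-injective 1+hp≡K)) (sym (heightOf≡0⇒colourOf≡0 q hq≡0))))
  placesFollow⇒cycleAdjacent (start refl) (ascent _ _) (inj₁ 1≡b) _ = inj₂ (inj₁ 1≡b)
  placesFollow⇒cycleAdjacent (start refl) (summit _) (inj₁ _) c≢ = ⊥-elim (c≢ refl)
  placesFollow⇒cycleAdjacent {b = b} (start refl) (descent _ b+1≡L _ _) (inj₁ refl) _ =
    inj₁ (inj₂ (refl , trans (ℕ.+-comm 1 b) b+1≡L))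
  placesFollow⇒cycleAdjacent (ascent _ _) (ascent _ _) (inj₁ 1+a≡b) _ = inj₂ (inj₁ 1+a≡b)
  placesFollow⇒cycleAdjacent (ascent _ _) (summit refl) (inj₁ 1+a≡1+m) _ = inj₂ (inj₁ 1+a≡1+m)
  placesFollow⇒cycleAdjacent (ascent _ _) (descent _ _ _ _) (inj₁ refl) c≢ = ⊥-elim (c≢ refl)
  placesFollow⇒cycleAdjacent (summit _) q (inj₁ 2+m≡hq) _ = ⊥-elim (ℕ.<-irrefl (sym 2+m≡hq) (heightOf<K q))
  placesFollow⇒cycleAdjacent (descent _ _ _ _) (ascent _ _) (inj₁ refl) c≢ = ⊥-elim (c≢ refl)
  placesFollow⇒cycleAdjacent (descent _ a+u≡L _ _) (summit refl) (inj₁ refl) _ =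
    inj₁ (inj₁ (descent-cancel refl a+u≡L))
  placesFollow⇒cycleAdjacent {b = b} (descent u a+u≡L _ _) (descent _ b+1+u≡L _ _) (inj₁ refl) _ =
    inj₁ (inj₁ (descent-cancel (trans (sym (ℕ.+-suc b u)) b+1+u≡L) a+u≡L))

  places-injective : ∀ {a b} (p : Place a) (q : Place b) → heightOf p ≡ heightOf q → colourOf p ≡ colourOf q → a ≡ b
  places-injective (start refl) (start refl) _ _ = refl
  places-injective (start _) (ascent 1≤b _) 0≡b _ = ⊥-elim (ℕ.<-irrefl 0≡b 1≤b)
  places-injective (start _) (descent _ _ 1≤u _) 0≡u _ = ⊥-elim (ℕ.<-irrefl 0≡u 1≤u)
  places-injective (ascent 1≤a _) (start _) a≡0 _ = ⊥-elim (ℕ.<-irrefl (sym a≡0) 1≤a)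
  places-injective (ascent _ _) (ascent _ _) a≡b _ = a≡b
  places-injective (ascent _ a≤m) (summit refl) a≡1+m _ = ⊥-elim (ℕ.<-irrefl a≡1+m (s≤s a≤m))
  places-injective {a} (ascent _ _) (descent _ _ _ _) refl c≡ = ⊥-elim (oneTwo-suc≢ a c≡)
  places-injective (summit refl) (ascent _ b≤m) 1+m≡b _ = ⊥-elim (ℕ.<-irrefl (sym 1+m≡b) (s≤s b≤m))
  places-injective (summit refl) (summit refl) _ _ = refl
  places-injective (summit _) (descent _ _ _ u≤m) 1+m≡u _ = ⊥-elim (ℕ.<-irrefl (sym 1+m≡u) (s≤s u≤m))
  places-injective (descent _ _ 1≤u _) (start _) u≡0 _ = ⊥-elim (ℕ.<-irrefl (sym u≡0) 1≤u)
  places-injective {b = b} (descent _ _ _ _) (ascent _ _) refl c≡ = ⊥-elim (oneTwo-suc≢ b (sym c≡))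
  places-injective (descent _ _ _ u≤m) (summit refl) u≡1+m _ = ⊥-elim (ℕ.<-irrefl u≡1+m (s≤s u≤m))
  places-injective (descent _ a+u≡L _ _) (descent _ b+u≡L _ _) refl _ = descent-cancel a+u≡L b+u≡L

  Good : ℕ → ℕ → Set
  Good a b = CycleAdjacent K (height a) (height b) × colour a ≢ colour b

  good-sym : ∀ {a b} → Good a b → Good b a
  good-sym (adjacent , c≢) = cycleAdjacent-sym adjacent , c≢ ∘ sym

  placesGood⇒good : ∀ {a b} (p : Place a) (q : Place b) →
    CycleAdjacent K (heightOf p) (heightOf q) → colourOf p ≢ colourOf q → Good a b
  placesGood⇒good p q adjacent c≢ =
    subst₂ (CycleAdjacent K) (sym (height≡ p)) (sym (height≡ q)) adjacent ,
    λ c≡ → c≢ (trans (sym (colour≡ p)) (trans c≡ (colour≡ q)))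

  follows⇒good : 1 ≤ m → ∀ {a b} → a < L → b < L → Follows L a b → Good a b
  follows⇒good 1≤m {a} a<L 1+a<L (inj₁ refl) with place a<L
  ... | start refl = placesGood⇒good (start refl) (ascent (s≤s z≤n) 1≤m) (inj₂ (inj₁ refl)) (λ ())
  ... | ascent 1≤a a≤m with ℕ.m≤n⇒m<n∨m≡n a≤m
  ...   | inj₁ a<m = placesGood⇒good (ascent 1≤a a≤m) (ascent (s≤s z≤n) a<m) (inj₂ (inj₁ refl)) (oneTwo-suc≢ a)
  ...   | inj₂ refl = placesGood⇒good (ascent 1≤a a≤m) (summit refl) (inj₂ (inj₁ refl)) (oneTwo≢0 a)
  follows⇒good 1≤m _ _ (inj₁ refl) | summit refl =
    placesGood⇒good (summit refl) (descent m refl 1≤m ℕ.≤-refl) (inj₁ (inj₁ refl)) (oneTwo≢0 (suc m) ∘ sym)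
  follows⇒good 1≤m _ 1+a<L (inj₁ refl) | descent 1 a+1≡L _ _ =
    ⊥-elim (ℕ.<-irrefl (trans (ℕ.+-comm 1 _) a+1≡L) 1+a<L)
  follows⇒good 1≤m {a} _ _ (inj₁ refl) | descent (suc (suc u)) a+2+u≡L 1≤u u≤m =
    placesGood⇒good {a} {suc a} (descent (suc (suc u)) a+2+u≡L 1≤u u≤m)
      (descent (suc u) (trans (sym (ℕ.+-suc a (suc u))) a+2+u≡L) (s≤s z≤n) (ℕ.≤-trans (ℕ.n≤1+n (suc u)) u≤m))
      (inj₁ (inj₁ refl)) (oneTwo-suc≢ (suc u))
  follows⇒good 1≤m {a} _ _ (inj₂ (refl , 1+a≡L)) =
    placesGood⇒good (descent 1 (trans (ℕ.+-comm a 1) 1+a≡L) (s≤s z≤n) 1≤m) (start refl) (inj₁ (inj₁ refl)) (λ ())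

  good⇔cycleAdjacent : 1 ≤ m → ∀ {a b} → a < L → b < L → Good a b ⇔ CycleAdjacent L a b
  good⇔cycleAdjacent 1≤m {a} {b} a<L b<L = mk⇔ ⇒ ⇐
    where
    p = place a<L
    q = place b<L
    ⇒ : Good a b → CycleAdjacent L a b
    ⇒ (adjacent , c≢) = [ (λ q→p → cycleAdjacent-sym (placesFollow⇒cycleAdjacent q p q→p (colourOf≢ ∘ sym)))
                        , (λ p→q → placesFollow⇒cycleAdjacent p q p→q colourOf≢)
                        ]′ (subst₂ (CycleAdjacent K) (height≡ p) (height≡ q) adjacent)
      where
      colourOf≢ : colourOf p ≢ colourOf q
      colourOf≢ c≡ = c≢ (trans (colour≡ p) (trans c≡ (sym (colour≡ q))))
    ⇐ : CycleAdjacent L a b → Good a b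
    ⇐ (inj₁ b→a) = good-sym {b} {a} (follows⇒good 1≤m b<L a<L b→a)
    ⇐ (inj₂ a→b) = follows⇒good 1≤m a<L b<L a→b

  height-colour-injective : ∀ {a b} → a < L → b < L → height a ≡ height b → colour a ≡ colour b → a ≡ b
  height-colour-injective a<L b<L h≡ c≡ = places-injective p q
    (trans (sym (height≡ p)) (trans h≡ (height≡ q))) (trans (sym (colour≡ p)) (trans c≡ (colour≡ q)))
    where
    p = place a<L
    q = place b<L

  height<K : ∀ {a} → a < L → height a < K
  height<K a<L = subst (_< K) (sym (height≡ (place a<L))) (heightOf<K (place a<L))

  colour<3 : ∀ {a} → a < L → colour a < 3
  colour<3 a<L = subst (_< 3) (sym (colour≡ (place a<L))) (colourOf<3 (place a<L))

-- For n = 1 + n₀: c + (2n + 1)(x + n₀ c) = x + n (2x + (2n₀ + 1) c).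
glue : ℕ → ℕ → ℕ → ℕ
glue n x c = c + suc (n + n) * (x + ℕ.pred n * c)

glue-%n : ∀ {n x} c .{{_ : NonZero n}} → x < n → glue n x c % n ≡ x
glue-%n {suc n₀} {x} c x<n = begin
  glue (suc n₀) x c % suc n₀                          ≡⟨ cong (_% suc n₀) (expand n₀ x c) ⟩
  (x + suc n₀ * (2 * x + (suc n₀ + n₀) * c)) % suc n₀ ≡⟨ %-remove-+ʳ x (m∣m*n (2 * x + (suc n₀ + n₀) * c)) ⟩
  x % suc n₀                                          ≡⟨ m<n⇒m%n≡m x<n ⟩
  x                                                   ∎
  where
  open ≡-Reasoning
  expand : ∀ n₀ x c → c + suc (suc n₀ + suc n₀) * (x + n₀ * c) ≡ x + suc n₀ * (2 * x + (suc n₀ + n₀) * c)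
  expand = solve-∀

glue-%p : ∀ n {p} x {c} .{{_ : NonZero p}} → p ∣ suc (n + n) → c < p → glue n x c % p ≡ c
glue-%p n x {c} p∣1+2n c<p = trans (%-remove-+ʳ c (∣m⇒∣m*n (x + ℕ.pred n * c) p∣1+2n)) (m<n⇒m%n≡m c<p)

record CycleRealisation (r K : ℕ) : Set where
  field
    n : ℕ
    primes : List ℕ
    primes-length : length primes ≡ r
    primes-unique : Unique primes
    primeDivisors : PrimeDivisorList n primes
    vertex : ℕ → ℕ
    vertex<n : ∀ {a} → a < K → vertex a < n
    vertex-injective : ∀ {a b} → a < K → b < K → vertex a ≡ vertex b → a ≡ b
    separatedCycle : SeparatedCycle primes K vertex

record FreshPrime (n : ℕ) : Set where
  field
    p : ℕ
    pp : Prime p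
    p∣1+2n : p ∣ suc (n + n)
    p∤n : ¬ p ∣ n
    3≤p : 3 ≤ p

freshPrime : ∀ {n} → 1 ≤ n → FreshPrime n
freshPrime {n} 1≤n with ∃primeDivisor (s≤s (ℕ.≤-trans 1≤n (ℕ.m≤m+n n n)))
... | p , pp , p∣1+2n = record { p = p ; pp = pp ; p∣1+2n = p∣1+2n ; p∤n = p∤n ; 3≤p = 3≤p }
  where
  p∤n : ¬ p ∣ n
  p∤n p∣n = prime∣1+2n⇒∤2n n pp p∣1+2n (∣m∣n⇒∣m+n p∣n p∣n)
  2∣2n : 2 ∣ n + n
  2∣2n = subst (2 ∣_) (cong (n +_) (ℕ.+-identityʳ n)) (m∣m*n n)
  3≤p : 3 ≤ p
  3≤p = ℕ.≤∧≢⇒< (ℕ.nonTrivial⇒n>1 p {{prime⇒nonTrivial pp}})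
    λ 2≡p → prime∣1+2n⇒∤2n n pp p∣1+2n (subst (_∣ n + n) 2≡p 2∣2n)

-- Vertex a of the doubled cycle lies over vertex (height a) modulo n and is colour a modulo p.
module Doubling {r m} (1≤m : 1 ≤ m) (R : CycleRealisation r (suc (suc m))) where

  open CycleRealisation R
  open Folding m

  1≤n : 1 ≤ n
  1≤n = ℕ.≤-trans (s≤s z≤n) (vertex<n {0} (s≤s z≤n))

  open FreshPrime (freshPrime 1≤n)

  instance
    n≢0 : NonZero n
    n≢0 = ℕ.>-nonZero 1≤n
    p≢0 : NonZero p
    p≢0 = prime⇒nonZero pp
    np≢0 : NonZero (n * p)
    np≢0 = ℕ.m*n≢0 n p

  glued : ℕ → ℕ
  glued a = glue n (vertex (height a)) (colour a)

  vertex′ : ℕ → ℕ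
  vertex′ a = glued a % (n * p)

  residue-vertex′-n : ∀ {a q} → a < L → q ∣ n → residue (vertex′ a) q ≡ residue (vertex (height a)) q
  residue-vertex′-n {a} {q} a<L q∣n = begin
    residue (glued a % (n * p)) q   ≡⟨ residue-%-multiple (glued a) (∣m⇒∣m*n p q∣n) ⟩
    residue (glued a) q             ≡⟨ residue-%-multiple (glued a) q∣n ⟨
    residue (glued a % n) q         ≡⟨ cong (λ x → residue x q) (glue-%n (colour a) (vertex<n (height<K a<L))) ⟩
    residue (vertex (height a)) q   ∎
    where open ≡-Reasoning

  residue-vertex′-p : ∀ {a} → a < L → residue (vertex′ a) p ≡ colour a
  residue-vertex′-p {a} a<L = begin
    residue (glued a % (n * p)) p   ≡⟨ residue-%-multiple (glued a) (n∣m*n n) ⟩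
    residue (glued a) p             ≡⟨ residue≡% (glued a) p ⟩
    glued a % p                     ≡⟨ glue-%p n (vertex (height a)) p∣1+2n (ℕ.<-≤-trans (colour<3 a<L) 3≤p) ⟩
    colour a                        ∎
    where open ≡-Reasoning

  vertex′-injective : ∀ {a b} → a < L → b < L → vertex′ a ≡ vertex′ b → a ≡ b
  vertex′-injective {a} {b} a<L b<L v′≡ = height-colour-injective a<L b<L
    (vertex-injective (height<K a<L) (height<K b<L) (begin
      vertex (height a)                 ≡⟨ m<n⇒m%n≡m (vertex<n (height<K a<L)) ⟨
      vertex (height a) % n             ≡⟨ residue≡% (vertex (height a)) n ⟨
      residue (vertex (height a)) n     ≡⟨ residue-vertex′-n a<L ∣-refl ⟨
      residue (vertex′ a) n             ≡⟨ cong (λ x → residue x n) v′≡ ⟩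
      residue (vertex′ b) n             ≡⟨ residue-vertex′-n b<L ∣-refl ⟩
      residue (vertex (height b)) n     ≡⟨ residue≡% (vertex (height b)) n ⟩
      vertex (height b) % n             ≡⟨ m<n⇒m%n≡m (vertex<n (height<K b<L)) ⟩
      vertex (height b)                 ∎))
    (trans (sym (residue-vertex′-p a<L)) (trans (cong (λ x → residue x p) v′≡) (residue-vertex′-p b<L)))
    where open ≡-Reasoning

  separated′⇔separated : ∀ {a b} → a < L → b < L →
    Separated primes (vertex′ a) (vertex′ b) ⇔ Separated primes (vertex (height a)) (vertex (height b))
  separated′⇔separated {a} {b} a<L b<L = mk⇔
    (λ s → All.tabulate λ q∈ e → All.lookup s q∈ (from (residues-agree q∈) e))
    (λ s → All.tabulate λ q∈ e → All.lookup s q∈ (to (residues-agree q∈) e))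
    where
    residues-agree : ∀ {q} → q ∈ primes → (residue (vertex′ a) q ≡ residue (vertex′ b) q) ⇔
                                         (residue (vertex (height a)) q ≡ residue (vertex (height b)) q)
    residues-agree {q} q∈primes = mk⇔
      (λ e → trans (sym (residue-vertex′-n a<L q∣n)) (trans e (residue-vertex′-n b<L q∣n)))
      (λ e → trans (residue-vertex′-n a<L q∣n) (trans e (sym (residue-vertex′-n b<L q∣n))))
      where q∣n = proj₂ (to (primeDivisors q) q∈primes)

  separatedCycle′ : SeparatedCycle (p ∷ primes) L vertex′
  separatedCycle′ {a} {b} a<L b<L = ⇔.trans (mk⇔ ⇒ ⇐) (good⇔cycleAdjacent 1≤m a<L b<L)
    where
    folded : Separated primes (vertex (height a)) (vertex (height b)) ⇔ CycleAdjacent K (height a) (height b)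
    folded = separatedCycle (height<K a<L) (height<K b<L)
    colours-agree : residue (vertex′ a) p ≡ residue (vertex′ b) p ⇔ colour a ≡ colour b
    colours-agree = mk⇔
      (λ e → trans (sym (residue-vertex′-p a<L)) (trans e (residue-vertex′-p b<L)))
      (λ e → trans (residue-vertex′-p a<L) (trans e (sym (residue-vertex′-p b<L))))
    ⇒ : Separated (p ∷ primes) (vertex′ a) (vertex′ b) → Good a b
    ⇒ (p-separated ∷ separated) =
      to folded (to (separated′⇔separated a<L b<L) separated) , p-separated ∘ from colours-agree
    ⇐ : Good a b → Separated (p ∷ primes) (vertex′ a) (vertex′ b)
    ⇐ (adjacent , c≢) = c≢ ∘ to colours-agree ∷ from (separated′⇔separated a<L b<L) (from folded adjacent)

  p∉primes : ∀ {q} → q ∈ primes → p ≢ q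
  p∉primes {q} q∈primes refl = p∤n (proj₂ (to (primeDivisors q) q∈primes))

  doubled : CycleRealisation (suc r) L
  doubled = record
    { n = n * p
    ; primes = p ∷ primes
    ; primes-length = cong suc primes-length
    ; primes-unique = All.tabulate p∉primes ∷ primes-unique
    ; primeDivisors = primeDivisors-*prime primeDivisors pp
    ; vertex = vertex′
    ; vertex<n = λ {a} _ → m%n<n (glued a) (n * p)
    ; vertex-injective = vertex′-injective
    ; separatedCycle = separatedCycle′
    }

follows? : ∀ L a b → Dec (Follows L a b)
follows? L a b = (suc a ≟ b) ⊎-dec ((b ≟ 0) ×-dec (suc a ≟ L))

separatedCycle? : ∀ ps K (w : ℕ → ℕ) →
  Dec (∀ {a} → a < K → ∀ {b} → b < K → Separated ps (w a) (w b) ⇔ CycleAdjacent K a b)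
separatedCycle? ps K w =
  ℕ.allUpTo? {P = λ a → ∀ {b} → b < K → SeparatedAdjacent a b} (λ a → ℕ.allUpTo? (separated⇔adjacent? a) K) K
  where
  SeparatedAdjacent : ℕ → ℕ → Set
  SeparatedAdjacent a b = Separated ps (w a) (w b) ⇔ CycleAdjacent K a b
  separated? : ∀ x y → Dec (Separated ps x y)
  separated? x y = All.all? (λ p → ¬? (residue x p ≟ residue y p)) ps
  separated⇔adjacent? : ∀ a b → Dec (SeparatedAdjacent a b)
  separated⇔adjacent? a b = map′ (λ h → mk⇔ (proj₁ h) (proj₂ h)) (λ e → to e , from e)
    ((separated? (w a) (w b) →-dec adjacent?) ×-dec (adjacent? →-dec separated? (w a) (w b)))
    where adjacent? = follows? K b a ⊎-dec follows? K a b

realisation₁ : CycleRealisation 1 4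
realisation₁ = record
  { n = 2 * 2
  ; primes = 2 ∷ []
  ; primes-length = refl
  ; primes-unique = [] ∷ []
  ; primeDivisors = primeDivisors-square prime[2]
  ; vertex = λ a → a
  ; vertex<n = λ a<4 → a<4
  ; vertex-injective = λ _ _ a≡b → a≡b
  ; separatedCycle = λ a<4 b<4 → toWitness {a? = separatedCycle? (2 ∷ []) 4 (λ a → a)} _ a<4 b<4
  }

realisation : ∀ r → 1 ≤ r → CycleRealisation r (2 ^ r + 2)
realisation 1 _ = realisation₁
realisation (suc (suc r)) _ =
  subst (CycleRealisation (suc (suc r))) (2+[m+m]≡2m+2 (2 ^ suc r))
    (Doubling.doubled (ℕ.m^n>0 2 (suc r))
      (subst (CycleRealisation (suc r)) (ℕ.+-comm (2 ^ suc r) 2) (realisation (suc r) (s≤s z≤n))))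
  where
  2+[m+m]≡2m+2 : ∀ m → suc (suc (m + m)) ≡ 2 * m + 2
  2+[m+m]≡2m+2 = solve-∀

realisation⇒inducedCycle : ∀ {r K} → 3 ≤ K → CycleRealisation r K →
  Σ ℕ λ n → (1 ≤ n) × HasExactlyPrimeDivisors n r × Σ (Fin K → Fin n) λ v → IsInducedCycle n K v
realisation⇒inducedCycle 3≤K R =
  n , ℕ.≤-trans (s≤s z≤n) (vertex<n {0} (ℕ.≤-trans (s≤s z≤n) 3≤K)) ,
  (primes , primes-length , primes-unique , primeDivisors) ,
  _ , separatedCycle⇒inducedCycle primeDivisors 3≤K vertex<n vertex-injective separatedCycle
  where open CycleRealisation R

mainTheorem10 : (r : ℕ) → 1 ≤ r →
    (Σ ℕ λ n → (1 ≤ n) × HasExactlyPrimeDivisors n r ×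
       Σ (Fin (2 ^ r + 2) → Fin n) λ v → IsInducedCycle n (2 ^ r + 2) v)
    × ((n k : ℕ) (v : Fin k → Fin n) → 1 ≤ n → HasExactlyPrimeDivisors n r →
       IsInducedCycle n k v → k ≤ 2 ^ r + 2)
mainTheorem10 r 1≤r =
  realisation⇒inducedCycle (ℕ.+-monoˡ-≤ 2 (ℕ.m^n>0 2 r)) (realisation r 1≤r) ,
  λ _ _ _ _ → inducedCycle⇒length≤
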